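{- Let $r\ge1$ be an integer and let $G$ be an $(r+1)$-path degenerate graph. If $G$ is a forest, then $\mathrm{arb}_r(G)=1$; otherwise $\mathrm{arb}_r(G)=r+1$.
   Context: The generalized $r$-arboricity $\mathrm{arb}_r(G)$ is the minimum number of colors in a (not necessarily proper) edge coloring of $G$ such that every cycle $C$ of $G$ receives at least $\min\{|C|,r+1\}$ colors. A strict ear of $G$ is a path with distinct endpoints whose internal vertices have degree $2$ in $G$; a $p$-reduction deletes an isolated vertex, a vertex of degree $1$, or the internal vertices of a strict ear of length at least $p$; $G$ is $p$-path degenerate if it reduces to the empty graph by $p$-reductions. -}

module Defs where

open import Data.Nat using (ℕ; zero; suc; _+_; _≤_; _⊔_; _⊓_)
open import Data.Nat.Properties using (_≟_)
open import Data.Fin using (Fin; zero; suc; toℕ; inject₁; lower₁)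
open import Data.Bool using (Bool; true; false; if_then_else_)
open import Data.Product using (Σ; ∃; _×_; _,_)
open import Relation.Nullary using (¬_; yes; no)
open import Relation.Binary.PropositionalEquality using (_≡_; _≢_)
open import Function using (_⇔_)

record Graph : Set where
  field
    n     : ℕ
    Adj   : Fin n → Fin n → Bool
    sym   : ∀ u v → Adj u v ≡ Adj v u
    irrefl : ∀ v → Adj v v ≡ false
open Graph public

Injective : ∀ {A B : Set} → (A → B) → Set
Injective f = ∀ x y → f x ≡ f y → x ≡ y

count : ∀ {m} → (Fin m → Bool) → ℕ
count {zero}  f = 0
count {suc m} f = (if f zero then 1 else 0) + count (λ i → f (suc i))

next : ∀ {l} → Fin (suc l) → Fin (suc l)
next {l} i with l ≟ toℕ i
... | yes _ = zero
... | no ne = suc (lower₁ i ne)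

-- A cycle of G: distinct vertices w 0, …, w l (l ≥ 2, so length suc l ≥ 3),
-- with w i adjacent to w (i+1 mod (suc l)).
record Cycle (G : Graph) : Set where
  field
    l     : ℕ
    len≥3 : 2 ≤ l
    w     : Fin (suc l) → Fin (n G)
    inj   : Injective w
    adj   : ∀ i → Adj G (w i) (w (next i)) ≡ true
open Cycle public

cycleLength : ∀ {G} → Cycle G → ℕ
cycleLength C = suc (l C)

Forest : Graph → Set
Forest G = ¬ Cycle G

HasEdge : Graph → Set
HasEdge G = Σ (Fin (n G)) λ u → Σ (Fin (n G)) λ v → Adj G u v ≡ true

-- An edge colouring with k colours (values on non-edges are irrelevant).
EdgeColouring : Graph → ℕ → Set
EdgeColouring G k = Σ (Fin (n G) → Fin (n G) → Fin k) λ c → ∀ u v → c u v ≡ c v u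

cycleEdgeColour : ∀ {G k} → EdgeColouring G k → (C : Cycle G) → Fin (suc (l C)) → Fin k
cycleEdgeColour (c , _) C i = c (w C i) (w C (next i))

ReceivesAtLeast : ∀ {G k} → EdgeColouring G k → Cycle G → ℕ → Set
ReceivesAtLeast col C t =
  Σ (Fin t → Fin (suc (l C))) λ f → Injective (λ j → cycleEdgeColour col C (f j))

GoodColouring : ℕ → (G : Graph) → (k : ℕ) → EdgeColouring G k → Set
GoodColouring r G k col = (C : Cycle G) → ReceivesAtLeast col C (cycleLength C ⊓ suc r)

IsArb : ℕ → Graph → ℕ → Set
IsArb r G k =
  (Σ (EdgeColouring G k) λ col → GoodColouring r G k col) ×
  (∀ j → (col : EdgeColouring G j) → GoodColouring r G j col → k ≤ j)

VSet : Graph → Set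
VSet G = Fin (n G) → Bool

degIn : (G : Graph) → VSet G → Fin (n G) → ℕ
degIn G S v = count (λ u → if S u then Adj G v u else false)

-- Distinct endpoints follow from injectivity (len ≥ 1).
record StrictEar (G : Graph) (S : VSet G) : Set where
  field
    len      : ℕ
    len≥1    : 1 ≤ len
    pv       : Fin (suc len) → Fin (n G)
    pinj     : Injective pv
    padj     : ∀ (i : Fin len) → Adj G (pv (inject₁ i)) (pv (suc i)) ≡ true
    pinS     : ∀ i → S (pv i) ≡ true
    pdeg     : ∀ i → toℕ i ≢ 0 → toℕ i ≢ len → degIn G S (pv i) ≡ 2
open StrictEar public

IsInternal : ∀ {G S} → StrictEar G S → Fin (n G) → Set
IsInternal P v = Σ (Fin (suc (len P))) λ i → (toℕ i ≢ 0) × (toℕ i ≢ len P) × (pv P i ≡ v)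

data Step (p : ℕ) (G : Graph) (S : VSet G) (S' : VSet G) : Set where
  delLow : (v : Fin (n G)) → S v ≡ true → degIn G S v ≤ 1 →
           (∀ u → (S' u ≡ true) ⇔ ((S u ≡ true) × (u ≢ v))) → Step p G S S'
  delEar : (P : StrictEar G S) → p ≤ len P →
           (∀ u → (S' u ≡ true) ⇔ ((S u ≡ true) × ¬ IsInternal P u)) → Step p G S S'

data Reduces (p : ℕ) (G : Graph) : VSet G → Set where
  done : ∀ {S} → (∀ v → S v ≡ false) → Reduces p G S
  step : ∀ {S S'} → Step p G S S' → Reduces p G S' → Reduces p G S

PathDegenerate : ℕ → Graph → Set
PathDegenerate p G = Reduces p G (λ _ → true)

-- Lower bound: in an (r+1)-path degenerate graph every cycle has length at least r + 1.
-- Follow the reduction: deleting a vertex of degree ≤ 1 never meets a cycle, and a cycle of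
-- the current induced subgraph through an interior vertex of a strict ear must traverse the
-- whole ear, because interior vertices have degree 2; so the cycle is at least as long as the
-- ear.  Hence every cycle receives r + 1 colours and at least r + 1 colours are needed.
-- Upper bound: colour along the reduction backwards.  When the interior of an ear of length
-- ≥ r + 1 comes back, give its t-th edge the colour min(t, r).  A new cycle through the ear
-- contains all its edges and so sees the colours 0, …, r; every other cycle keeps its colours.

module Submission where

open import Defs renaming (sym to adj-sym)
open import Data.Nat using (ℕ; zero; suc; _≤_; _<_; _⊓_; z≤n; s≤s; _≤?_; >-nonZero⁻¹)
open import Data.Nat.Properties
  renaming (_≟_ to _≟ℕ_)
  using (+-suc; ≤-trans; ≤-pred; <⇒≤; <⇒≢; ≤∧≢⇒<; ≤⇒≯; n≤1+n; n≢0⇒n>0; m⊓n≤n; m≤n⇒m⊓n≡m; m≥n⇒m⊓n≡n; ⊓-comm)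
open import Data.Fin using (Fin; zero; suc; toℕ; inject₁; fromℕ; fromℕ<)
open import Data.Fin.Properties
  using (_≟_; nonZeroIndex; toℕ-injective; toℕ-fromℕ; toℕ-fromℕ<; toℕ-inject₁; toℕ-lower₁; toℕ<n; injective⇒≤; any?)
open import Data.Bool using (Bool; true; false; if_then_else_; _∨_)
open import Data.Bool.Properties using (∨-zeroʳ)
open import Data.Product using (Σ; _×_; _,_; proj₁; proj₂)
open import Data.Sum using (_⊎_; inj₁; inj₂)
open import Function using (_∘_; _⇔_; Equivalence)
open import Relation.Nullary using (¬_; Dec; yes; no; does; contradiction)
open import Relation.Nullary.Decidable using (¬?; _×-dec_; dec-true; dec-false; decidable-stable)
open import Relation.Binary.PropositionalEquality
open ≡-Reasoning

remove : ∀ {m} → Fin m → (Fin m → Bool) → Fin m → Bool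
remove a f u = if does (u ≟ a) then false else f u

count-remove : ∀ {m} (f : Fin m → Bool) {a} → f a ≡ true → count f ≡ suc (count (remove a f))
count-remove {suc m} f {zero}  fa rewrite fa = refl
count-remove {suc m} f {suc a} fa
  rewrite count-remove (λ i → f (suc i)) fa = +-suc (if f zero then 1 else 0) _

remove-true : ∀ {m} (f : Fin m → Bool) {a b} → f b ≡ true → b ≢ a → remove a f b ≡ true
remove-true f {a} {b} fb b≢a with b ≟ a
... | yes b≡a = contradiction b≡a b≢a
... | no _    = fb

1≤count : ∀ {m} (f : Fin m → Bool) {a} → f a ≡ true → 1 ≤ count f
1≤count f fa rewrite count-remove f fa = s≤s z≤n

2≤count : ∀ {m} (f : Fin m → Bool) {a b} → f a ≡ true → f b ≡ true → b ≢ a → 2 ≤ count f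
2≤count f fa fb b≢a rewrite count-remove f fa = s≤s (1≤count (remove _ f) (remove-true f fb b≢a))

3≤count : ∀ {m} (f : Fin m → Bool) {a b c} → f a ≡ true → f b ≡ true → f c ≡ true →
          b ≢ a → c ≢ a → c ≢ b → 3 ≤ count f
3≤count f fa fb fc b≢a c≢a c≢b rewrite count-remove f fa =
  s≤s (2≤count (remove _ f) (remove-true f fb b≢a) (remove-true f fc c≢a) c≢b)

interval-spread : ∀ (Q : ℕ → Set) {L} →
                  (∀ t → suc t < L → Q t → Q (suc t)) → (∀ t → suc t < L → Q (suc t) → Q t) →
                  ∀ {s} → s < L → Q s → ∀ t → t < L → Q t
interval-spread Q {L} up down {s} s<L Qs t t<L = climb t t<L (descend s s<L Qs)
  where
  descend : ∀ s → s < L → Q s → Q 0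
  descend zero    _   q = q
  descend (suc s) s<L q = descend s (<⇒≤ s<L) (down s s<L q)
  climb : ∀ t → t < L → Q 0 → Q t
  climb zero    _   q = q
  climb (suc t) t<L q = up t t<L (climb t (<⇒≤ t<L) q)

next-spec : ∀ {l} (i : Fin (suc l)) →
            (toℕ i ≡ l × next i ≡ zero) ⊎ (toℕ i < l × toℕ (next i) ≡ suc (toℕ i))
next-spec {l} i with l ≟ℕ toℕ i
... | yes l≡i = inj₁ (sym l≡i , refl)
... | no  l≢i = inj₂ (≤∧≢⇒< (≤-pred (toℕ<n i)) (λ i≡l → l≢i (sym i≡l)) , cong suc (toℕ-lower₁ i l≢i))

prev : ∀ {l} → Fin (suc l) → Fin (suc l)
prev {l} zero = fromℕ l
prev (suc k)  = inject₁ k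

next-prev : ∀ {l} (j : Fin (suc l)) → next (prev j) ≡ j
next-prev {l} zero with next-spec (fromℕ l)
... | inj₁ (_ , n≡0)  = n≡0
... | inj₂ (l<l , _)  = contradiction (toℕ-fromℕ l) (<⇒≢ l<l)
next-prev (suc k) with next-spec (inject₁ k)
... | inj₁ (k≡l , _)  = contradiction (trans (sym (toℕ-inject₁ k)) k≡l) (<⇒≢ (toℕ<n k))
... | inj₂ (_ , n≡k+1) = toℕ-injective (trans n≡k+1 (cong suc (toℕ-inject₁ k)))

next²≢id : ∀ {l} → 2 ≤ l → (i : Fin (suc l)) → next (next i) ≢ i
next²≢id {l} 2≤l i nni≡i with next-spec i | next-spec (next i)
... | inj₁ (_ , ni≡0) | inj₁ (ni≡l , _) =
  <⇒≢ (≤-trans (s≤s z≤n) 2≤l) (trans (sym (cong toℕ ni≡0)) ni≡l)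
... | inj₁ (i≡l , ni≡0) | inj₂ (_ , nni) = <⇒≢ 2≤l (begin
  1                         ≡⟨ cong (suc ∘ toℕ) (sym ni≡0) ⟩
  suc (toℕ (next i))        ≡⟨ sym nni ⟩
  toℕ (next (next i))       ≡⟨ cong toℕ nni≡i ⟩
  toℕ i                     ≡⟨ i≡l ⟩
  l                         ∎)
... | inj₂ (_ , ni) | inj₁ (ni≡l , nni≡0) = <⇒≢ 2≤l (begin
  1                         ≡⟨ cong (suc ∘ toℕ) (sym nni≡0) ⟩
  suc (toℕ (next (next i))) ≡⟨ cong (suc ∘ toℕ) nni≡i ⟩
  suc (toℕ i)               ≡⟨ sym ni ⟩
  toℕ (next i)              ≡⟨ ni≡l ⟩
  l                         ∎)
... | inj₂ (_ , ni) | inj₂ (_ , nni) =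
  <⇒≢ (s≤s (n≤1+n (toℕ i))) (trans (cong toℕ (sym nni≡i)) (trans nni (cong suc ni)))

prev≢next : ∀ {l} → 2 ≤ l → (j : Fin (suc l)) → prev j ≢ next j
prev≢next 2≤l j p≡n = next²≢id 2≤l (prev j) (trans (cong next (next-prev j)) (sym p≡n))

module _ (G : Graph) where

  record Within (S : VSet G) (C : Cycle G) : Set where
    constructor within
    field inside : ∀ j → S (w C j) ≡ true
  open Within

  OnCycle : Cycle G → Fin (n G) → Set
  OnCycle C u = Σ (Fin (suc (l C))) λ j → w C j ≡ u

  record CycleEdge (C : Cycle G) (a b : Fin (n G)) : Set where
    constructor cycleEdge
    field
      position : Fin (suc (l C))
      ends     : (w C position ≡ a × w C (next position) ≡ b) ⊎ (w C position ≡ b × w C (next position) ≡ a)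
  open CycleEdge

  cycleEdge-left : ∀ {C a b} → CycleEdge C a b → OnCycle C a
  cycleEdge-left (cycleEdge j (inj₁ (wj≡a , _))) = j , wj≡a
  cycleEdge-left (cycleEdge j (inj₂ (_ , wn≡a))) = next j , wn≡a

  cycleEdge-right : ∀ {C a b} → CycleEdge C a b → OnCycle C b
  cycleEdge-right (cycleEdge j (inj₁ (_ , wn≡b))) = next j , wn≡b
  cycleEdge-right (cycleEdge j (inj₂ (wj≡b , _))) = j , wj≡b

  cycleEdge-colour : ∀ {k} (col : EdgeColouring G k) {C a b} (e : CycleEdge C a b) →
                     cycleEdgeColour col C (position e) ≡ proj₁ col a b
  cycleEdge-colour col         (cycleEdge j (inj₁ (refl , refl))) = refl
  cycleEdge-colour (c , c-sym) (cycleEdge j (inj₂ (refl , refl))) = c-sym _ _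

  empty-no-cycle : ∀ {S C} → (∀ v → S v ≡ false) → ¬ Within S C
  empty-no-cycle empty C⊆S = contradiction (trans (sym (inside C⊆S zero)) (empty _)) λ ()

  within-restrict : ∀ {S S′ C} {Q : Fin (n G) → Set} → (∀ u → (S′ u ≡ true) ⇔ (S u ≡ true × Q u)) →
                    Within S C → (∀ j → Q (w C j)) → Within S′ C
  within-restrict {C = C} S′⇔ C⊆S q = within λ j → Equivalence.from (S′⇔ (w C j)) (inside C⊆S j , q j)

  -- degIn G S v is definitionally count (adjIn S v).
  adjIn : VSet G → Fin (n G) → Fin (n G) → Bool
  adjIn S v u = if S u then Adj G v u else false

  adjIn-intro : ∀ {S v u} → S u ≡ true → Adj G v u ≡ true → adjIn S v u ≡ true
  adjIn-intro Su vu rewrite Su = vu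

  degree2-neighbours : ∀ {S v a b x} → degIn G S v ≡ 2 →
                       adjIn S v a ≡ true → adjIn S v b ≡ true → b ≢ a →
                       adjIn S v x ≡ true → x ≡ a ⊎ x ≡ b
  degree2-neighbours {a = a} {b} {x} deg≡2 va vb b≢a vx with x ≟ a | x ≟ b
  ... | yes x≡a | _       = inj₁ x≡a
  ... | no _    | yes x≡b = inj₂ x≡b
  ... | no x≢a  | no x≢b  = contradiction (subst (3 ≤_) deg≡2 (3≤count _ va vb vx b≢a x≢a x≢b)) λ { (s≤s (s≤s ())) }

  module _ {S : VSet G} {C : Cycle G} (C⊆S : Within S C) where

    cycle-prev-adjIn : ∀ j → adjIn S (w C j) (w C (prev j)) ≡ true
    cycle-prev-adjIn j = adjIn-intro {S} (inside C⊆S (prev j))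
      (subst (λ i → Adj G (w C i) (w C (prev j)) ≡ true) (next-prev j)
             (trans (adj-sym G _ _) (adj C (prev j))))

    cycle-next-adjIn : ∀ j → adjIn S (w C j) (w C (next j)) ≡ true
    cycle-next-adjIn j = adjIn-intro {S} (inside C⊆S (next j)) (adj C j)

    cycle-next≢prev : ∀ j → w C (next j) ≢ w C (prev j)
    cycle-next≢prev j e = prev≢next (len≥3 C) j (sym (inj C _ _ e))

    cycle-degree≥2 : ∀ j → 2 ≤ degIn G S (w C j)
    cycle-degree≥2 j = 2≤count _ (cycle-prev-adjIn j) (cycle-next-adjIn j) (cycle-next≢prev j)

    lowDegree-off-cycle : ∀ {v} → degIn G S v ≤ 1 → ∀ j → w C j ≢ v
    lowDegree-off-cycle deg≤1 j refl = ≤⇒≯ deg≤1 (cycle-degree≥2 j)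

    degree2-on-cycle : ∀ {v a b} → degIn G S v ≡ 2 →
                       adjIn S v a ≡ true → adjIn S v b ≡ true → b ≢ a →
                       OnCycle C v → CycleEdge C a v × CycleEdge C v b
    degree2-on-cycle deg≡2 va vb b≢a (j , refl)
      with degree2-neighbours deg≡2 va vb b≢a (cycle-prev-adjIn j)
         | degree2-neighbours deg≡2 va vb b≢a (cycle-next-adjIn j)
    ... | inj₁ p≡a | inj₂ n≡b =
      cycleEdge (prev j) (inj₁ (p≡a , cong (w C) (next-prev j))) , cycleEdge j (inj₁ (refl , n≡b))
    ... | inj₂ p≡b | inj₁ n≡a =
      cycleEdge j (inj₂ (refl , n≡a)) , cycleEdge (prev j) (inj₂ (p≡b , cong (w C) (next-prev j)))
    ... | inj₁ p≡a | inj₁ n≡a = contradiction (trans n≡a (sym p≡a)) (cycle-next≢prev j)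
    ... | inj₂ p≡b | inj₂ n≡b = contradiction (trans n≡b (sym p≡b)) (cycle-next≢prev j)

  -- Strict ears

  module Ear {S : VSet G} (P : StrictEar G S) where

    -- Ear vertices indexed by ℕ; indices beyond len P are clamped to the last vertex.
    clamp : ℕ → Fin (suc (len P))
    clamp k = fromℕ< (s≤s (m⊓n≤n k (len P)))

    vertex : ℕ → Fin (n G)
    vertex k = pv P (clamp k)

    toℕ-clamp : ∀ {k} → k ≤ len P → toℕ (clamp k) ≡ k
    toℕ-clamp k≤len = trans (toℕ-fromℕ< _) (m≤n⇒m⊓n≡m k≤len)

    clamp-toℕ : ∀ i → clamp (toℕ i) ≡ i
    clamp-toℕ i = toℕ-injective (toℕ-clamp (≤-pred (toℕ<n i)))

    vertex-injective : ∀ {k k′} → k ≤ len P → k′ ≤ len P → vertex k ≡ vertex k′ → k ≡ k′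
    vertex-injective {k} {k′} k≤len k′≤len e = begin
      k                ≡⟨ sym (toℕ-clamp k≤len) ⟩
      toℕ (clamp k)    ≡⟨ cong toℕ (pinj P _ _ e) ⟩
      toℕ (clamp k′)   ≡⟨ toℕ-clamp k′≤len ⟩
      k′               ∎

    vertex-adjacent : ∀ {t} → t < len P → Adj G (vertex t) (vertex (suc t)) ≡ true
    vertex-adjacent {t} t<len =
      subst₂ (λ x y → Adj G (pv P x) (pv P y) ≡ true) inject₁i≡t suci≡t+1 (padj P i)
      where
      i : Fin (len P)
      i = fromℕ< t<len
      inject₁i≡t : inject₁ i ≡ clamp t
      inject₁i≡t = toℕ-injective
        (trans (toℕ-inject₁ i) (trans (toℕ-fromℕ< t<len) (sym (toℕ-clamp (<⇒≤ t<len)))))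
      suci≡t+1 : suc i ≡ clamp (suc t)
      suci≡t+1 = toℕ-injective (trans (cong suc (toℕ-fromℕ< t<len)) (sym (toℕ-clamp t<len)))

    vertex-internal : ∀ {k} → 0 < k → k < len P → IsInternal P (vertex k)
    vertex-internal 0<k k<len =
      clamp _ , (λ c≡0 → <⇒≢ 0<k (trans (sym c≡0) c≡k)) , (λ c≡len → <⇒≢ k<len (trans (sym c≡k) c≡len)) , refl
      where c≡k = toℕ-clamp (<⇒≤ k<len)

    internal-vertex : ∀ {u} → IsInternal P u → Σ ℕ λ k → 0 < k × k < len P × vertex k ≡ u
    internal-vertex (i , i≢0 , i≢len , pi≡u) =
      toℕ i , n≢0⇒n>0 i≢0 , ≤∧≢⇒< (≤-pred (toℕ<n i)) i≢len , trans (cong (pv P) (clamp-toℕ i)) pi≡u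

    internal-degree : ∀ {u} → IsInternal P u → degIn G S u ≡ 2
    internal-degree (i , i≢0 , i≢len , refl) = pdeg P i i≢0 i≢len

    isInternal? : ∀ u → Dec (IsInternal P u)
    isInternal? u = any? λ i → ¬? (toℕ i ≟ℕ 0) ×-dec ¬? (toℕ i ≟ℕ len P) ×-dec (pv P i ≟ u)

    EarEdge : Cycle G → ℕ → Set
    EarEdge C t = CycleEdge C (vertex t) (vertex (suc t))

    EarOnCycle : Cycle G → Set
    EarOnCycle C = ∀ t → t < len P → EarEdge C t

    ear-length : ∀ {C} → EarOnCycle C → len P ≤ cycleLength C
    ear-length {C} ear = injective⇒≤ position-injective
      where
      start : (x : Fin (len P)) → OnCycle C (vertex (toℕ x))
      start x = cycleEdge-left (ear (toℕ x) (toℕ<n x))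
      position-injective : ∀ {x y} → proj₁ (start x) ≡ proj₁ (start y) → x ≡ y
      position-injective {x} {y} e = toℕ-injective (vertex-injective (<⇒≤ (toℕ<n x)) (<⇒≤ (toℕ<n y))
        (trans (sym (proj₂ (start x))) (trans (cong (w C) e) (proj₂ (start y)))))

    module _ {C : Cycle G} (C⊆S : Within S C) where

      around-interior : ∀ t → suc t < len P → OnCycle C (vertex (suc t)) → EarEdge C t × EarEdge C (suc t)
      around-interior t t+1<len = degree2-on-cycle C⊆S
        (internal-degree (vertex-internal (s≤s z≤n) t+1<len))
        (adjIn-intro {S} (pinS P _) (trans (adj-sym G _ _) (vertex-adjacent (<⇒≤ t+1<len))))
        (adjIn-intro {S} (pinS P _) (vertex-adjacent t+1<len))
        λ e → <⇒≢ (s≤s (n≤1+n t)) (sym (vertex-injective t+1<len (<⇒≤ (<⇒≤ t+1<len)) e))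

      ear-on-cycle : ∀ {u} → IsInternal P u → OnCycle C u → EarOnCycle C
      ear-on-cycle int on with internal-vertex int
      ... | suc t , _ , t+1<len , refl =
        interval-spread (EarEdge C) up down (<⇒≤ t+1<len) (proj₁ (around-interior t t+1<len on))
        where
        up : ∀ t → suc t < len P → EarEdge C t → EarEdge C (suc t)
        up t t+1<len e = proj₂ (around-interior t t+1<len (cycleEdge-right e))
        down : ∀ t → suc t < len P → EarEdge C (suc t) → EarEdge C t
        down t t+1<len e = proj₁ (around-interior t t+1<len (cycleEdge-left e))

  hits? : ∀ {S} (P : StrictEar G S) (C : Cycle G) → Dec (Σ (Fin (suc (l C))) λ j → IsInternal P (w C j))
  hits? P C = any? λ j → Ear.isInternal? P (w C j)

  reduces⇒long-cycles : ∀ {p S} → Reduces p G S → (C : Cycle G) → Within S C → p ≤ cycleLength C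
  reduces⇒long-cycles (done empty) C C⊆S = contradiction C⊆S (empty-no-cycle empty)
  reduces⇒long-cycles (step (delLow v _ deg≤1 S′⇔) rest) C C⊆S =
    reduces⇒long-cycles rest C (within-restrict S′⇔ C⊆S (lowDegree-off-cycle C⊆S deg≤1))
  reduces⇒long-cycles (step (delEar P p≤len S′⇔) rest) C C⊆S with hits? P C
  ... | yes (j , int) = ≤-trans p≤len (Ear.ear-length P (Ear.ear-on-cycle P C⊆S int (j , refl)))
  ... | no avoids     = reduces⇒long-cycles rest C (within-restrict S′⇔ C⊆S λ j int → avoids (j , int))

  -- Recolouring along an ear

  module Recolouring (r : ℕ) (1≤r : 1 ≤ r) {S : VSet G} (P : StrictEar G S) (r<len : r < len P) where
    open Ear P

    internal : Fin (n G) → Bool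
    internal u = does (isInternal? u)

    earIndex : Fin (n G) → ℕ
    earIndex u with any? (λ i → pv P i ≟ u)
    ... | yes (i , _) = toℕ i
    ... | no _        = 0

    earIndex-vertex : ∀ {k} → k ≤ len P → earIndex (vertex k) ≡ k
    earIndex-vertex {k} k≤len with any? (λ i → pv P i ≟ vertex k)
    ... | yes (i , pi≡vk) = trans (cong toℕ (pinj P _ _ pi≡vk)) (toℕ-clamp k≤len)
    ... | no none         = contradiction (clamp k , refl) none

    capped : ℕ → Fin (suc r)
    capped k = fromℕ< (s≤s (m⊓n≤n k r))

    toℕ-capped : ∀ {k} → k ≤ r → toℕ (capped k) ≡ k
    toℕ-capped k≤r = trans (toℕ-fromℕ< _) (m≤n⇒m⊓n≡m k≤r)

    earColour : Fin (n G) → Fin (n G) → Fin (suc r)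
    earColour u v = capped (earIndex u ⊓ earIndex v)

    recolourMap : (Fin (n G) → Fin (n G) → Fin (suc r)) → Fin (n G) → Fin (n G) → Fin (suc r)
    recolourMap c u v = if internal u ∨ internal v then earColour u v else c u v

    recolourMap-sym : ∀ {c} → (∀ u v → c u v ≡ c v u) → ∀ u v → recolourMap c u v ≡ recolourMap c v u
    recolourMap-sym c-sym u v with internal u | internal v
    ... | true  | true  = cong capped (⊓-comm (earIndex u) (earIndex v))
    ... | true  | false = cong capped (⊓-comm (earIndex u) (earIndex v))
    ... | false | true  = cong capped (⊓-comm (earIndex u) (earIndex v))
    ... | false | false = c-sym u v

    recolour : EdgeColouring G (suc r) → EdgeColouring G (suc r)
    recolour (c , c-sym) = recolourMap c , recolourMap-sym c-sym

    recolourMap-interior : ∀ c {u v} → internal u ∨ internal v ≡ true → recolourMap c u v ≡ earColour u v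
    recolourMap-interior c {u} {v} touches =
      subst (λ b → (if b then earColour u v else c u v) ≡ earColour u v) (sym touches) refl

    recolourMap-exterior : ∀ c {u v} → internal u ∨ internal v ≡ false → recolourMap c u v ≡ c u v
    recolourMap-exterior c {u} {v} avoids =
      subst (λ b → (if b then earColour u v else c u v) ≡ c u v) (sym avoids) refl

    -- Edge 0 reaches the interior only through vertex 1, which is interior because len P ≥ 2:
    -- this is where 1 ≤ r is needed.
    ear-edge-touches-interior : ∀ {t} → t ≤ r → internal (vertex t) ∨ internal (vertex (suc t)) ≡ true
    ear-edge-touches-interior {zero} _ =
      trans (cong (internal (vertex 0) ∨_) (dec-true (isInternal? _) (vertex-internal (s≤s z≤n) 1<len)))
            (∨-zeroʳ _)
      where 1<len = ≤-trans (s≤s 1≤r) r<len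
    ear-edge-touches-interior {suc t} t<r =
      cong (_∨ internal (vertex (suc (suc t))))
           (dec-true (isInternal? _) (vertex-internal (s≤s z≤n) (≤-trans (s≤s t<r) r<len)))

    recolour-ear-edge : ∀ c {t} → t ≤ r → toℕ (recolourMap c (vertex t) (vertex (suc t))) ≡ t
    recolour-ear-edge c {t} t≤r = begin
      toℕ (recolourMap c (vertex t) (vertex (suc t)))
        ≡⟨ cong toℕ (recolourMap-interior c (ear-edge-touches-interior t≤r)) ⟩
      toℕ (capped (earIndex (vertex t) ⊓ earIndex (vertex (suc t))))
        ≡⟨ cong (toℕ ∘ capped) (cong₂ _⊓_ (earIndex-vertex (<⇒≤ t<len)) (earIndex-vertex t<len)) ⟩
      toℕ (capped (t ⊓ suc t))
        ≡⟨ cong (toℕ ∘ capped) (m≤n⇒m⊓n≡m (n≤1+n t)) ⟩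
      toℕ (capped t)
        ≡⟨ toℕ-capped t≤r ⟩
      t ∎
      where t<len = ≤-trans (s≤s t≤r) r<len

    recolour-preserves : ∀ col (C : Cycle G) {t} → (∀ j → ¬ IsInternal P (w C j)) →
                         ReceivesAtLeast col C t → ReceivesAtLeast (recolour col) C t
    recolour-preserves (c , _) C avoids (f , f-inj) =
      f , λ x y e → f-inj x y (trans (sym (unchanged (f x))) (trans e (unchanged (f y))))
      where
      unchanged : ∀ j → recolourMap c (w C j) (w C (next j)) ≡ c (w C j) (w C (next j))
      unchanged j = recolourMap-exterior c
        (cong₂ _∨_ (dec-false (isInternal? _) (avoids j)) (dec-false (isInternal? _) (avoids (next j))))

    recolour-receives : ∀ col {C} → EarOnCycle C → ReceivesAtLeast (recolour col) C (suc r)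
    recolour-receives col {C} ear = position ∘ edge , λ x y e →
      toℕ-injective (trans (sym (colour-of x)) (trans (cong toℕ e) (colour-of y)))
      where
      edge : (x : Fin (suc r)) → EarEdge C (toℕ x)
      edge x = ear (toℕ x) (≤-trans (toℕ<n x) r<len)
      colour-of : ∀ x → toℕ (cycleEdgeColour (recolour col) C (position (edge x))) ≡ toℕ x
      colour-of x = trans (cong toℕ (cycleEdge-colour (recolour col) (edge x)))
                          (recolour-ear-edge (proj₁ col) (≤-pred (toℕ<n x)))

  GoodOn : (r : ℕ) → VSet G → EdgeColouring G (suc r) → Set
  GoodOn r S col = ∀ C → Within S C → ReceivesAtLeast col C (cycleLength C ⊓ suc r)

  constColouring : ∀ {k} → EdgeColouring G (suc k)
  constColouring = (λ _ _ → zero) , λ _ _ → refl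

  reduces⇒goodColouring : ∀ r → 1 ≤ r → ∀ {S} → Reduces (suc r) G S → Σ (EdgeColouring G (suc r)) (GoodOn r S)
  reduces⇒goodColouring r 1≤r (done empty) = constColouring , λ C C⊆S → contradiction C⊆S (empty-no-cycle empty)
  reduces⇒goodColouring r 1≤r (step (delLow v _ deg≤1 S′⇔) rest) with reduces⇒goodColouring r 1≤r rest
  ... | col , good = col , λ C C⊆S → good C (within-restrict S′⇔ C⊆S (lowDegree-off-cycle C⊆S deg≤1))
  reduces⇒goodColouring r 1≤r (step (delEar P r<len S′⇔) rest) with reduces⇒goodColouring r 1≤r rest
  ... | col , good = recolour col , good′
    where
    open Recolouring r 1≤r P r<len
    good′ : GoodOn r _ (recolour col)
    good′ C C⊆S with hits? P C
    ... | yes (j , int) =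
      subst (ReceivesAtLeast (recolour col) C) (sym (m≥n⇒m⊓n≡n long)) (recolour-receives col ear)
      where
      ear  = Ear.ear-on-cycle P C⊆S int (j , refl)
      long = ≤-trans r<len (Ear.ear-length P ear)
    ... | no avoids =
      recolour-preserves col C (λ j int → avoids (j , int))
        (good C (within-restrict S′⇔ C⊆S λ j int → avoids (j , int)))

  receives⇒≤ : ∀ {k} (col : EdgeColouring G k) (C : Cycle G) {t} → ReceivesAtLeast col C t → t ≤ k
  receives⇒≤ _ _ (f , f-inj) = injective⇒≤ λ {x} {y} → f-inj x y

mainTheorem14 : (r : ℕ) → 1 ≤ r → (G : Graph) → HasEdge G → PathDegenerate (suc r) G →
    (Forest G → IsArb r G 1) × (¬ Forest G → IsArb r G (suc r))
mainTheorem14 r 1≤r G (u , _) reduces = forest , nonForest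
  where
  forest : Forest G → IsArb r G 1
  forest acyclic = (constColouring G , λ C → contradiction C acyclic) ,
                   λ k col _ → >-nonZero⁻¹ k {{nonZeroIndex (proj₁ col u u)}}
  nonForest : ¬ Forest G → IsArb r G (suc r)
  nonForest cyclic with reduces⇒goodColouring G r 1≤r reduces
  ... | col , good = (col , λ C → good C everything) , minimal
    where
    everything : ∀ {C} → Within G (λ _ → true) C
    everything = within λ _ → refl
    -- ¬ Forest G only says ¬ ¬ Cycle G; the bound can still be extracted since ≤ is decidable.
    minimal : ∀ k (col′ : EdgeColouring G k) → GoodColouring r G k col′ → suc r ≤ k
    minimal k col′ good′ = decidable-stable (suc r ≤? k) λ r≰k → cyclic λ C →
      r≰k (receives⇒≤ G col′ C (subst (ReceivesAtLeast col′ C)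
                                (m≥n⇒m⊓n≡n (reduces⇒long-cycles G reduces C everything)) (good′ C)))
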